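{- For all integers $n,m\geq 1$, letting $K_{n,m}$ be the complete bipartite graph with parts of sizes $n$ and $m$: ${\rm I}_e(K_{n,m})=0$ if $n\neq m$, and ${\rm I}_e(K_{n,m})=n$ if $n=m$.
   Context: All graphs are finite and simple. A graph is locally irregular if no two adjacent vertices have the same degree. For a graph $G=(V,E)$, a set $S\subseteq E$ is an edge-irregulator of $G$ if $G-S$ is locally irregular, and ${\rm I}_e(G)$ is the minimum cardinality of an edge-irregulator of $G$. -}

module Defs where

open import Data.Bool using (Bool; true; false; not; _∧_; _xor_)
open import Data.Bool.Properties using (xor-same)
open import Data.Nat using (ℕ; zero; suc; _+_; _≤_; _<ᵇ_)
open import Data.Fin using (Fin; toℕ)
open import Data.List using (List; []; _∷_; allFin)
open import Data.Product using (Σ; _×_; _,_)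
open import Relation.Binary.PropositionalEquality using (_≡_; _≢_; refl; cong; cong₂)

record Graph (N : ℕ) : Set where
  field
    adj     : Fin N → Fin N → Bool
    adj-sym : ∀ u v → adj u v ≡ adj v u
    irrefl  : ∀ v → adj v v ≡ false
open Graph public

countB : {A : Set} → (A → Bool) → List A → ℕ
countB p [] = 0
countB p (x ∷ xs) with p x
... | true  = suc (countB p xs)
... | false = countB p xs

degree : ∀ {N} → Graph N → Fin N → ℕ
degree {N} G v = countB (adj G v) (allFin N)

LocallyIrregular : ∀ {N} → Graph N → Set
LocallyIrregular G = ∀ u v → adj G u v ≡ true → degree G u ≢ degree G v

record EdgeSet {N : ℕ} (G : Graph N) : Set where
  field
    mem     : Fin N → Fin N → Bool
    mem-sym : ∀ u v → mem u v ≡ mem v u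
    mem-sub : ∀ u v → mem u v ≡ true → adj G u v ≡ true
open EdgeSet public

-- cardinality of an edge set: number of ordered pairs (u , v) with
-- toℕ u < toℕ v and {u,v} ∈ S, i.e. the number of (unordered) edges in S
card : ∀ {N} {G : Graph N} → EdgeSet G → ℕ
card {N} S = sumL (λ u → countB (λ v → (toℕ u <ᵇ toℕ v) ∧ mem S u v) (allFin N)) (allFin N)
  where
  sumL : (Fin N → ℕ) → List (Fin N) → ℕ
  sumL f [] = 0
  sumL f (x ∷ xs) = f x + sumL f xs

_─_ : ∀ {N} (G : Graph N) → EdgeSet G → Graph N
G ─ S = record
  { adj     = λ u v → adj G u v ∧ not (mem S u v)
  ; adj-sym = λ u v → cong₂ (λ a b → a ∧ not b) (adj-sym G u v) (mem-sym S u v)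
  ; irrefl  = λ v → cong (λ a → a ∧ not (mem S v v)) (irrefl G v)
  }

IsEdgeIrregulator : ∀ {N} (G : Graph N) → EdgeSet G → Set
IsEdgeIrregulator G S = LocallyIrregular (G ─ S)

IeIs : ∀ {N} → Graph N → ℕ → Set
IeIs G k =
  Σ (EdgeSet G) (λ S → IsEdgeIrregulator G S × card S ≡ k)
  × (∀ (S : EdgeSet G) → IsEdgeIrregulator G S → k ≤ card S)

private
  xor-comm : ∀ a b → a xor b ≡ b xor a
  xor-comm true true = refl
  xor-comm true false = refl
  xor-comm false true = refl
  xor-comm false false = refl

-- complete bipartite graph K_{n,m} on Fin (n + m):
-- parts {i | toℕ i < n} (size n) and {i | toℕ i ≥ n} (size m)
K : (n m : ℕ) → Graph (n + m)
K n m = record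
  { adj     = λ u v → (toℕ u <ᵇ n) xor (toℕ v <ᵇ n)
  ; adj-sym = λ u v → xor-comm (toℕ u <ᵇ n) (toℕ v <ᵇ n)
  ; irrefl  = λ v → xor-same (toℕ v <ᵇ n)
  }

{-# OPTIONS --safe #-}
-- If n ≠ m, K_{n,m} is already locally irregular: every edge joins a vertex of degree m to one of
-- degree n. If n = m, an untouched vertex on each side of an edge-irregulator S would give two
-- adjacent vertices of degree n in K_{n,n} − S, so S touches every vertex of one side; since every
-- edge has exactly one end on each side, S has at least n edges. Conversely, deleting the n edges
-- at one vertex isolates it and leaves the remaining degrees n on its side and n − 1 on the other.
module Submission where

open import Defs
open import Data.Bool using (Bool; true; false; not; _∧_; _xor_)
open import Data.Bool.Properties using (_≟_; ∧-identityʳ; ∧-zeroʳ; ∧-inverseʳ; ¬-not; not-¬; not-injective)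
open import Data.Empty using (⊥-elim)
open import Data.Fin using (Fin; zero; suc; toℕ)
open import Data.Fin.Properties using (any?)
open import Data.List using (List; []; _∷_; allFin; tabulate)
open import Data.Nat using (ℕ; zero; suc; _+_; _≤_; _<ᵇ_; z≤n; s≤s)
open import Data.Nat.Properties using (+-0-commutativeMonoid; +-mono-≤; m≤m+n; +-identityʳ; 1+n≢n)
open import Algebra.Properties.CommutativeMonoid.Sum +-0-commutativeMonoid
  using (sum; sum-syntax; sum-cong-≗; sum-replicate-zero; sum-remove; ∑-comm)
open import Data.Product using (_×_; _,_; ∃; map₂)
open import Data.Sum using (_⊎_; inj₁; inj₂)
open import Function using (_∘_; id)
open import Relation.Nullary using (¬_; yes; no)
open import Relation.Nullary.Decidable using (_×-dec_; ¬?; decidable-stable)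
open import Relation.Unary using (Decidable)
open import Relation.Binary.PropositionalEquality
  using (_≡_; _≢_; refl; sym; trans; cong; cong₂; subst; module ≡-Reasoning)

open ≡-Reasoning

ind : Bool → ℕ
ind true  = 1
ind false = 0

module _ {A : Set} where

  countB-cons : (p : A → Bool) (x : A) (xs : List A) → countB p (x ∷ xs) ≡ ind (p x) + countB p xs
  countB-cons p x xs with p x
  ... | true  = refl
  ... | false = refl

  countB-cong : {p q : A → Bool} → (∀ x → p x ≡ q x) → (xs : List A) → countB p xs ≡ countB q xs
  countB-cong p≗q []       = refl
  countB-cong {p} {q} p≗q (x ∷ xs) = begin
    countB p (x ∷ xs)         ≡⟨ countB-cons p x xs ⟩
    ind (p x) + countB p xs   ≡⟨ cong₂ _+_ (cong ind (p≗q x)) (countB-cong p≗q xs) ⟩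
    ind (q x) + countB q xs   ≡⟨ countB-cons q x xs ⟨
    countB q (x ∷ xs)         ∎

  countB-tabulate : (p : A → Bool) {n : ℕ} (g : Fin n → A) → countB p (tabulate g) ≡ ∑[ i < n ] ind (p (g i))
  countB-tabulate p {zero}  g = refl
  countB-tabulate p {suc n} g =
    trans (countB-cons p (g zero) _) (cong (ind (p (g zero)) +_) (countB-tabulate p (g ∘ suc)))

countB-allFin : ∀ {n} (p : Fin n → Bool) → countB p (allFin n) ≡ ∑[ i < n ] ind (p i)
countB-allFin p = countB-tabulate p id

∑-mono-≤ : ∀ {n} {f g : Fin n → ℕ} → (∀ i → f i ≤ g i) → sum f ≤ sum g
∑-mono-≤ {zero}  f≤g = z≤n
∑-mono-≤ {suc n} f≤g = +-mono-≤ (f≤g zero) (∑-mono-≤ (f≤g ∘ suc))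

∑-zero : ∀ {n} {f : Fin n → ℕ} → (∀ i → f i ≡ 0) → sum f ≡ 0
∑-zero {n} f≡0 = trans (sum-cong-≗ f≡0) (sum-replicate-zero n)

term≤∑ : ∀ {n} (f : Fin n → ℕ) (i : Fin n) → f i ≤ sum f
term≤∑ {suc n} f i = subst (f i ≤_) (sym (sum-remove {i = i} f)) (m≤m+n (f i) _)

ind≤∑ind : ∀ {n} (b : Bool) (q : Fin n → Bool) → (b ≡ true → ∃ λ i → q i ≡ true) →
  ind b ≤ ∑[ i < n ] ind (q i)
ind≤∑ind false q _ = z≤n
ind≤∑ind {n} true q witness with witness refl
... | i , qi = subst (λ c → ind c ≤ ∑[ j < n ] ind (q j)) qi (term≤∑ (ind ∘ q) i)

∑ind≤∑∑ind : ∀ {n} (p : Fin n → Bool) (q : Fin n → Fin n → Bool) →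
  (∀ u → p u ≡ true → ∃ λ w → q u w ≡ true) →
  ∑[ u < n ] ind (p u) ≤ ∑[ u < n ] ∑[ w < n ] ind (q u w)
∑ind≤∑∑ind p q witness = ∑-mono-≤ λ u → ind≤∑ind (p u) (q u) (witness u)

module _ {N : ℕ} {G : Graph N} where

  Touched : EdgeSet G → Fin N → Set
  Touched S u = ∃ λ w → mem S u w ≡ true

  touched? : (S : EdgeSet G) → Decidable (Touched S)
  touched? S u = any? λ w → mem S u w ≟ true

  all-touched-or-untouched : (S : EdgeSet G) (P : Fin N → Bool) →
    (∀ u → P u ≡ true → Touched S u) ⊎ ∃ λ u → P u ≡ true × ¬ Touched S u
  all-touched-or-untouched S P with any? (λ u → (P u ≟ true) ×-dec ¬? (touched? S u))
  ... | yes found = inj₂ found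
  ... | no  none  = inj₁ λ u Pu → decidable-stable (touched? S u) λ ¬t → none (u , Pu , ¬t)

  untouched : (S : EdgeSet G) {u : Fin N} → ¬ Touched S u → ∀ w → mem S u w ≡ false
  untouched S ¬t w = ¬-not λ e → ¬t (w , e)

  degree-─-untouched : (S : EdgeSet G) {u : Fin N} → (∀ w → mem S u w ≡ false) →
    degree (G ─ S) u ≡ degree G u
  degree-─-untouched S {u} free =
    countB-cong (λ w → trans (cong (λ b → adj G u w ∧ not b) (free w)) (∧-identityʳ _)) (allFin N)

  ─-⊆ : (S : EdgeSet G) {u v : Fin N} → adj (G ─ S) u v ≡ true → adj G u v ≡ true
  ─-⊆ S {u} {v} uv with adj G u v
  ... | true  = refl
  ... | false = uv

  -- `card` counts each edge of S once, at its endpoint of smaller index.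
  ascending : EdgeSet G → Fin N → Fin N → Bool
  ascending S u v = (toℕ u <ᵇ toℕ v) ∧ mem S u v

  -- `card` sums its rows with a function local to `Defs`, which cannot be named here; the meta
  -- `sumRows` is solved to it by unification once the `with`s turn its arguments into variables.
  private
    mutual
      sumRows : (S : EdgeSet G) → (Fin N → ℕ) → List (Fin N) → ℕ
      sumRows S = _

      card-sumRows : (S : EdgeSet G) →
        card S ≡ sumRows S (λ u → countB (ascending S u) (allFin N)) (allFin N)
      card-sumRows S with allFin N
      ... | us with (λ u → countB (ascending S u) us)
      ... | row = refl

    sumRows-tabulate : (S : EdgeSet G) (f : Fin N → ℕ) {n : ℕ} (g : Fin n → Fin N) →
      sumRows S f (tabulate g) ≡ ∑[ i < n ] f (g i)
    sumRows-tabulate S f {zero}  g = refl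
    sumRows-tabulate S f {suc n} g = cong (f (g zero) +_) (sumRows-tabulate S f (g ∘ suc))

  card-∑∑ : (S : EdgeSet G) → card S ≡ ∑[ u < N ] ∑[ v < N ] ind (ascending S u v)
  card-∑∑ S = begin
    card S                                                   ≡⟨ card-sumRows S ⟩
    sumRows S (λ u → countB (ascending S u) (allFin N)) (allFin N)
                                                             ≡⟨ sumRows-tabulate S _ id ⟩
    ∑[ u < N ] countB (ascending S u) (allFin N)             ≡⟨ sum-cong-≗ (countB-allFin ∘ ascending S) ⟩
    ∑[ u < N ] ∑[ v < N ] ind (ascending S u v)              ∎

  card-≥-ascending : (S : EdgeSet G) (p : Fin N → Bool) →
    (∀ u → p u ≡ true → ∃ λ w → ascending S u w ≡ true) → ∑[ u < N ] ind (p u) ≤ card S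
  card-≥-ascending S p witness =
    subst (_ ≤_) (sym (card-∑∑ S)) (∑ind≤∑∑ind p (ascending S) witness)

  card-≥-descending : (S : EdgeSet G) (p : Fin N → Bool) →
    (∀ v → p v ≡ true → ∃ λ w → ascending S w v ≡ true) → ∑[ v < N ] ind (p v) ≤ card S
  card-≥-descending S p witness =
    subst (_ ≤_) (sym (trans (card-∑∑ S) (∑-comm (λ u v → ind (ascending S u v)))))
      (∑ind≤∑∑ind p (λ v w → ascending S w v) witness)

  ∅ : EdgeSet G
  ∅ = record { mem = λ _ _ → false ; mem-sym = λ _ _ → refl ; mem-sub = λ _ _ () }

  card-∅ : card ∅ ≡ 0
  card-∅ = trans (card-∑∑ ∅) (∑-zero λ u → ∑-zero {f = ind ∘ ascending ∅ u} λ v →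
    cong ind (∧-zeroʳ (toℕ u <ᵇ toℕ v)))

module _ {N : ℕ} (G : Graph (suc N)) where

  star₀ : EdgeSet G
  star₀ = record { mem = mem₀ ; mem-sym = mem₀-sym ; mem-sub = mem₀-sub }
    where
    mem₀ : Fin (suc N) → Fin (suc N) → Bool
    mem₀ zero    v       = adj G zero v
    mem₀ (suc u) zero    = adj G (suc u) zero
    mem₀ (suc u) (suc v) = false

    mem₀-sym : ∀ u v → mem₀ u v ≡ mem₀ v u
    mem₀-sym zero    zero    = refl
    mem₀-sym zero    (suc v) = adj-sym G zero (suc v)
    mem₀-sym (suc u) zero    = adj-sym G (suc u) zero
    mem₀-sym (suc u) (suc v) = refl

    mem₀-sub : ∀ u v → mem₀ u v ≡ true → adj G u v ≡ true
    mem₀-sub zero    v       uv = uv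
    mem₀-sub (suc u) zero    uv = uv
    mem₀-sub (suc u) (suc v) ()

  star₀-isolates : ∀ v → adj (G ─ star₀) zero v ≡ false
  star₀-isolates v = ∧-inverseʳ (adj G zero v)

  degree-─-star₀ : ∀ u → degree G (suc u) ≡ ind (adj G (suc u) zero) + degree (G ─ star₀) (suc u)
  degree-─-star₀ u = begin
    degree G (suc u)
      ≡⟨ countB-allFin (adj G (suc u)) ⟩
    ind a₀ + ∑[ w < N ] ind (adj G (suc u) (suc w))
      ≡⟨ cong₂ (λ b s → ind a₀ + (ind b + s)) (∧-inverseʳ a₀) rest ⟨
    ind a₀ + (ind (a₀ ∧ not a₀) + ∑[ w < N ] ind (adj G (suc u) (suc w) ∧ not false))
      ≡⟨ cong (ind a₀ +_) (countB-allFin (adj (G ─ star₀) (suc u))) ⟨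
    ind a₀ + degree (G ─ star₀) (suc u)
      ∎
    where
    a₀ : Bool
    a₀ = adj G (suc u) zero
    rest : ∑[ w < N ] ind (adj G (suc u) (suc w) ∧ not false) ≡ ∑[ w < N ] ind (adj G (suc u) (suc w))
    rest = sum-cong-≗ λ w → cong ind (∧-identityʳ (adj G (suc u) (suc w)))

  card-star₀ : card star₀ ≡ degree G zero
  card-star₀ = begin
    card star₀                                    ≡⟨ card-∑∑ star₀ ⟩
    degree₀ + ∑[ u < N ] rowSum (suc u)           ≡⟨ cong (degree₀ +_) (∑-zero later-rows-empty) ⟩
    degree₀ + 0                                   ≡⟨ +-identityʳ degree₀ ⟩
    ind false + degree₀                           ≡⟨ cong (λ b → ind b + degree₀) (irrefl G zero) ⟨
    ind (adj G zero zero) + degree₀               ≡⟨ countB-allFin (adj G zero) ⟨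
    degree G zero                                 ∎
    where
    degree₀ : ℕ
    degree₀ = ∑[ v < N ] ind (adj G zero (suc v))
    rowSum : Fin (suc N) → ℕ
    rowSum u = ∑[ v < suc N ] ind (ascending star₀ u v)
    later-rows-empty : ∀ u → rowSum (suc u) ≡ 0
    later-rows-empty u = ∑-zero {f = ind ∘ ascending star₀ (suc u)} λ where
      zero    → refl
      (suc v) → cong ind (∧-zeroʳ (suc (toℕ u) <ᵇ suc (toℕ v)))

left : ∀ {N} → ℕ → Fin N → Bool
left n u = toℕ u <ᵇ n

<ᵇ-≮ᵇ-trans : ∀ i j n → (i <ᵇ n) ≡ true → (j <ᵇ n) ≡ false → (i <ᵇ j) ≡ true
<ᵇ-≮ᵇ-trans i       j       zero    ()
<ᵇ-≮ᵇ-trans zero    zero    (suc n) _  ()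
<ᵇ-≮ᵇ-trans zero    (suc j) (suc n) _  _  = refl
<ᵇ-≮ᵇ-trans (suc i) zero    (suc n) _  ()
<ᵇ-≮ᵇ-trans (suc i) (suc j) (suc n) i<n j≮n = <ᵇ-≮ᵇ-trans i j n i<n j≮n

module _ {n m : ℕ} where

  K-neighbour-of-left : ∀ {u w} → adj (K n m) u w ≡ true → left n u ≡ true → left n w ≡ false
  K-neighbour-of-left {w = w} uw lu = not-injective (subst (λ a → a xor left n w ≡ true) lu uw)

  K-neighbour-of-right : ∀ {u w} → adj (K n m) u w ≡ true → left n u ≡ false → left n w ≡ true
  K-neighbour-of-right {w = w} uw ru = subst (λ a → a xor left n w ≡ true) ru uw

  count-left : ∑[ i < n + m ] ind (left n i) ≡ n
  count-left = go n
    where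
    go : ∀ n → ∑[ i < n + m ] ind (left n i) ≡ n
    go zero    = ∑-zero {m} (λ _ → refl)
    go (suc n) = cong suc (go n)

  count-right : ∑[ i < n + m ] ind (not (left n i)) ≡ m
  count-right = go n
    where
    go : ∀ n → ∑[ i < n + m ] ind (not (left n i)) ≡ m
    go zero    = ones m
      where
      ones : ∀ m → ∑[ i < m ] 1 ≡ m
      ones zero    = refl
      ones (suc m) = cong suc (ones m)
    go (suc n) = go n

  degree-K-left : ∀ {u} → left n u ≡ true → degree (K n m) u ≡ m
  degree-K-left {u} lu = begin
    degree (K n m) u                             ≡⟨ countB-allFin (adj (K n m) u) ⟩
    ∑[ w < n + m ] ind (left n u xor left n w)   ≡⟨ sum-cong-≗ {n + m} (λ w → cong (λ a → ind (a xor left n w)) lu) ⟩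
    ∑[ w < n + m ] ind (not (left n w))          ≡⟨ count-right ⟩
    m                                            ∎

  degree-K-right : ∀ {u} → left n u ≡ false → degree (K n m) u ≡ n
  degree-K-right {u} ru = begin
    degree (K n m) u                             ≡⟨ countB-allFin (adj (K n m) u) ⟩
    ∑[ w < n + m ] ind (left n u xor left n w)   ≡⟨ sum-cong-≗ {n + m} (λ w → cong (λ a → ind (a xor left n w)) ru) ⟩
    ∑[ w < n + m ] ind (left n w)                ≡⟨ count-left ⟩
    n                                            ∎

  K─-irregular : (S : EdgeSet (K n m)) →
    (∀ u v → adj (K n m ─ S) u v ≡ true → left n u ≡ true → left n v ≡ false →
      degree (K n m ─ S) u ≢ degree (K n m ─ S) v) →
    IsEdgeIrregulator (K n m) S
  K─-irregular S left-right u v uv = by-side (left n u) refl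
    where
    by-side : ∀ b → left n u ≡ b → degree (K n m ─ S) u ≢ degree (K n m ─ S) v
    by-side true  lu = left-right u v uv lu (K-neighbour-of-left (─-⊆ S uv) lu)
    by-side false lu = left-right v u vu (K-neighbour-of-right (─-⊆ S uv) lu) lu ∘ sym
      where
      vu : adj (K n m ─ S) v u ≡ true
      vu = trans (adj-sym (K n m ─ S) v u) uv

  ascending-from-left : (S : EdgeSet (K n m)) {u w : Fin (n + m)} →
    left n u ≡ true → mem S u w ≡ true → ascending S u w ≡ true
  ascending-from-left S {u} {w} lu uw =
    cong₂ _∧_ (<ᵇ-≮ᵇ-trans (toℕ u) (toℕ w) n lu (K-neighbour-of-left (mem-sub S u w uw) lu)) uw

  ascending-to-right : (S : EdgeSet (K n m)) {v w : Fin (n + m)} →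
    left n v ≡ false → mem S v w ≡ true → ascending S w v ≡ true
  ascending-to-right S {v} {w} rv vw =
    cong₂ _∧_ (<ᵇ-≮ᵇ-trans (toℕ w) (toℕ v) n (K-neighbour-of-right (mem-sub S v w vw) rv) rv)
      (trans (mem-sym S w v) vw)

  untouched-left-right-adjacent : (S : EdgeSet (K n m)) {u v : Fin (n + m)} →
    left n u ≡ true → left n v ≡ false → (∀ w → mem S u w ≡ false) → adj (K n m ─ S) u v ≡ true
  untouched-left-right-adjacent S lu rv u-free =
    cong₂ (λ a b → a ∧ not b) (cong₂ _xor_ lu rv) (u-free _)

irregulator-card-≥ : ∀ n (S : EdgeSet (K n n)) → IsEdgeIrregulator (K n n) S → n ≤ card S
irregulator-card-≥ n S irregular with all-touched-or-untouched S (left n)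
... | inj₁ lefts-touched =
  subst (_≤ card S) (count-left {n} {n})
    (card-≥-ascending S (left n) λ u lu → map₂ (ascending-from-left {n} {n} S lu) (lefts-touched u lu))
... | inj₂ (u , lu , u-free) with all-touched-or-untouched S (not ∘ left n)
...   | inj₁ rights-touched =
  subst (_≤ card S) (count-right {n} {n})
    (card-≥-descending S (not ∘ left n) λ v rv →
      map₂ (ascending-to-right {n} {n} S (not-injective rv)) (rights-touched v rv))
...   | inj₂ (v , rv , v-free) =
  ⊥-elim (irregular u v (untouched-left-right-adjacent {n} {n} S lu (not-injective rv) (untouched S u-free))
    (trans (free-degree lu u-free) (sym (free-degree (not-injective rv) v-free))))
  where
  free-degree : ∀ {b x} → left n x ≡ b → ¬ Touched S x → degree (K n n ─ S) x ≡ n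
  free-degree {true}  lx x-free = trans (degree-─-untouched S (untouched S x-free)) (degree-K-left {n} {n} lx)
  free-degree {false} lx x-free = trans (degree-─-untouched S (untouched S x-free)) (degree-K-right {n} {n} lx)

∅-irregulator : ∀ {n m} → n ≢ m → IsEdgeIrregulator (K n m) ∅
∅-irregulator {n} {m} n≢m = K─-irregular {n} {m} ∅ λ u v _ lu rv du≡dv → n≢m (begin
  n                       ≡⟨ degree-K-right {n} {m} rv ⟨
  degree (K n m) v        ≡⟨ degree-─-untouched {G = K n m} ∅ (λ _ → refl) ⟨
  degree (K n m ─ ∅) v    ≡⟨ du≡dv ⟨
  degree (K n m ─ ∅) u    ≡⟨ degree-─-untouched {G = K n m} ∅ (λ _ → refl) ⟩
  degree (K n m) u        ≡⟨ degree-K-left {n} {m} lu ⟩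
  m                       ∎)

module _ (k : ℕ) where

  private
    G : Graph (suc k + suc k)
    G = K (suc k) (suc k)

    d : Fin (suc k + suc k) → ℕ
    d = degree (G ─ star₀ G)

  -- `adj G x zero` computes to `left (suc k) x xor true`, as vertex zero is on the left.
  star₀-irregulator : IsEdgeIrregulator G (star₀ G)
  star₀-irregulator = K─-irregular {suc k} {suc k} (star₀ G) left-right
    where
    left-degree : ∀ {u} → left (suc k) (suc u) ≡ true → d (suc u) ≡ suc k
    left-degree {u} lu = begin
      d (suc u)                              ≡⟨ cong (λ b → ind (b xor true) + d (suc u)) lu ⟨
      ind (adj G (suc u) zero) + d (suc u)   ≡⟨ degree-─-star₀ G u ⟨
      degree G (suc u)                       ≡⟨ degree-K-left {suc k} {suc k} {suc u} lu ⟩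
      suc k                                  ∎

    right-degree : ∀ {v} → left (suc k) (suc v) ≡ false → suc (d (suc v)) ≡ suc k
    right-degree {v} rv = begin
      suc (d (suc v))                        ≡⟨ cong (λ b → ind (b xor true) + d (suc v)) rv ⟨
      ind (adj G (suc v) zero) + d (suc v)   ≡⟨ degree-─-star₀ G v ⟨
      degree G (suc v)                       ≡⟨ degree-K-right {suc k} {suc k} {suc v} rv ⟩
      suc k                                  ∎

    left-right : ∀ u v → adj (G ─ star₀ G) u v ≡ true → left (suc k) u ≡ true → left (suc k) v ≡ false →
      d u ≢ d v
    left-right zero    v       uv _ _ = ⊥-elim (not-¬ (star₀-isolates G v) uv)
    left-right (suc u) zero    uv _ _ =
      ⊥-elim (not-¬ (star₀-isolates G (suc u)) (trans (adj-sym (G ─ star₀ G) zero (suc u)) uv))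
    left-right (suc u) (suc v) _ lu rv du≡dv = 1+n≢n (begin
      suc (suc k)       ≡⟨ cong suc (left-degree lu) ⟨
      suc (d (suc u))   ≡⟨ cong suc du≡dv ⟩
      suc (d (suc v))   ≡⟨ right-degree rv ⟩
      suc k             ∎)

  card-star₀-K : card (star₀ G) ≡ suc k
  card-star₀-K = trans (card-star₀ G) (degree-K-left {suc k} {suc k} {zero} refl)

IeIs-K-unbalanced : ∀ {n m} → n ≢ m → IeIs (K n m) 0
IeIs-K-unbalanced {n} {m} n≢m = (∅ , ∅-irregulator n≢m , card-∅ {G = K n m}) , λ _ _ → z≤n

IeIs-K-balanced : ∀ k → IeIs (K (suc k) (suc k)) (suc k)
IeIs-K-balanced k =
  (star₀ (K (suc k) (suc k)) , star₀-irregulator k , card-star₀-K k) , irregulator-card-≥ (suc k)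

theorem5 : ∀ (n m : ℕ) → 1 ≤ n → 1 ≤ m →
    (n ≢ m → IeIs (K n m) 0) × (n ≡ m → IeIs (K n m) n)
theorem5 (suc k) m (s≤s z≤n) _ = IeIs-K-unbalanced , balanced
  where
  balanced : suc k ≡ m → IeIs (K (suc k) m) (suc k)
  balanced refl = IeIs-K-balanced k
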